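{- Let $r,s\ge0$ be integers, $n=r+s+2$, and \[ \mathbf a=(1,\underbrace{0,\dots,0}_{r},1,\underbrace{0,\dots,0}_{s},-2)\in\mathbb{Z}^{n+1}. \] Then the number of vertices of the flow polytope $\mathcal{F}_{K_{n+1}}(\mathbf a)$ is $2^{r+1}3^s$.
   Context: $K_{n+1}$ is the complete graph on $[n+1]$ with one edge $(i,j)$ for each $1\le i<j\le n+1$. For an integer vector $\mathbf a=(a_1,\dots,a_{n+1})$ with entries summing to $0$, the flow polytope $\mathcal{F}_{K_{n+1}}(\mathbf a)\subset\mathbb{R}^{\binom{n+1}2}$ is the set of nonnegative real weightings $(f_{ij})_{i<j}$ of the edges such that for each vertex $i$, $\sum_{g<i}f_{gi}+a_i=\sum_{j>i}f_{ij}$.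
   Formalization: The edge weights are rational rather than real, so the points and vertices of $\mathcal{F}_{K_{n+1}}(\mathbf a)$, and the convex combinations and their coefficient in the vertex condition, are taken over ℚ. -}

module Defs where

open import Data.Nat as ℕ using (ℕ; zero; suc; _^_)
open import Data.Integer as ℤ using (ℤ; +_; -[1+_])
open import Data.Fin as Fin using (Fin; toℕ; _<?_)
open import Data.Rational using (ℚ; 0ℚ; _+_; _*_; _-_; _≤_; _<_; _/_)
open import Data.Bool using (if_then_else_)
open import Data.Product using (Σ; ∃; _×_; _,_)
open import Relation.Nullary using (¬_)
open import Relation.Nullary.Decidable using (⌊_⌋)
open import Relation.Binary.PropositionalEquality using (_≡_; _≢_)

sumFin : ∀ {n} → (Fin n → ℚ) → ℚ
sumFin {zero}  f = 0ℚ
sumFin {suc n} f = f Fin.zero + sumFin (λ i → f (Fin.suc i))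

-- A point of ℝ^{edges of K_N} (rational coordinates): f i j is the weight of
-- edge (i,j); only entries with i < j are meaningful (the others are ignored).
Flow : ℕ → Set
Flow N = Fin N → Fin N → ℚ

_≈F_ : ∀ {N} → Flow N → Flow N → Set
_≈F_ {N} f g = (i j : Fin N) → i Fin.< j → f i j ≡ g i j

inflow : ∀ {N} → Flow N → Fin N → ℚ
inflow f i = sumFin (λ g → if ⌊ g <? i ⌋ then f g i else 0ℚ)

outflow : ∀ {N} → Flow N → Fin N → ℚ
outflow f i = sumFin (λ j → if ⌊ i <? j ⌋ then f i j else 0ℚ)

InFlowPolytope : ∀ {N} → (Fin N → ℤ) → Flow N → Set
InFlowPolytope {N} a f =
  ((i j : Fin N) → i Fin.< j → 0ℚ ≤ f i j) ×
  ((i : Fin N) → inflow f i + (a i / 1) ≡ outflow f i)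

convex : ∀ {N} → ℚ → Flow N → Flow N → Flow N
convex t g h i j = t * g i j + (Data.Rational.1ℚ - t) * h i j

IsVertex : ∀ {N} → (Fin N → ℤ) → Flow N → Set
IsVertex {N} a f =
  InFlowPolytope a f ×
  ((g h : Flow N) (t : ℚ) → InFlowPolytope a g → InFlowPolytope a h →
   0ℚ < t → t < Data.Rational.1ℚ → f ≈F convex t g h → g ≈F h)

NumVertices : ∀ {N} → (Fin N → ℤ) → ℕ → Set
NumVertices {N} a K =
  Σ (Fin K → Flow N) λ v →
    ((k : Fin K) → IsVertex a (v k)) ×
    ((k l : Fin K) → k ≢ l → ¬ (v k ≈F v l)) ×
    ((f : Flow N) → IsVertex a f → ∃ λ k → f ≈F v k)

-- The net-flow vector a = (1, 0^r, 1, 0^s, -2) ∈ ℤ^{r+s+3}.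
aVec : (r s : ℕ) → Fin (suc (suc (suc (r ℕ.+ s)))) → ℤ
aVec r s i with toℕ i ℕ.≟ 0 | toℕ i ℕ.≟ suc r | toℕ i ℕ.≟ suc (suc (r ℕ.+ s))
... | Relation.Nullary.yes _ | _ | _ = + 1
... | Relation.Nullary.no _ | Relation.Nullary.yes _ | _ = + 1
... | Relation.Nullary.no _ | Relation.Nullary.no _ | Relation.Nullary.yes _ = -[1+ 1 ]
... | Relation.Nullary.no _ | Relation.Nullary.no _ | Relation.Nullary.no _ = + 0

{-# OPTIONS --safe #-}
module Submission where

-- Induct by deleting the first vertex.  When every vertex but the last has nonnegative supply,
-- F(t b₁ + (1 - t) b₂) = t F(b₁) + (1 - t) F(b₂): split the outflow of vertex 0 in proportion
-- to its two supplies and recurse.  Hence the outflow row of a vertex of F(b) is an extreme point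
-- of the simplex {ρ ≥ 0, Σ ρ = b₀}, i.e. all of b₀ leaves along a single edge (0, j), and the
-- vertices with that row are exactly the vertices of the flow polytope of the remaining complete
-- graph with b₀ added to the supply of j.  This gives a recursion for the number of vertices.
-- For a = e₀ + e_{r+1} - 2 e_n every supply met in the recursion has the form e_a + e_b - 2 e_m,
-- and the recursion for these is solved in closed form.

open import Defs
open import Algebra.Bundles using (CommutativeRing)
import Algebra.Properties.Semiring.Sum as SemiringSum
open import Data.Bool using (true; false; if_then_else_)
open import Data.Empty using (⊥)
open import Data.Fin as Fin using (Fin; zero; suc; toℕ; _<?_)
import Data.Fin.Properties as Finₚ
open import Data.Nat using (ℕ; zero; suc; _*_; _^_; z≤n; s≤s)
import Data.Nat as ℕ
import Data.Nat.Properties as ℕₚ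
open import Algebra.Properties.CommutativeMonoid.Sum ℕₚ.+-0-commutativeMonoid
  using (sum; sum-syntax; sum-cong-≗; ∑-distrib-+)
open import Data.Nat.Tactic.RingSolver using (solve-∀)
open import Data.Product using (Σ; ∃; ∃₂; _×_; _,_; proj₁; proj₂)
open import Data.Rational
  using (ℚ; 0ℚ; 1ℚ; ½; _+_; _-_; -_; _≤_; _<_; _/_; _≟_; 1/_; ≢-nonZero; nonNegative)
  renaming (_*_ to _·_)
import Data.Rational.Properties as ℚ
open import Data.Rational.Solver using (module +-*-Solver)
open import Data.Sum using (_⊎_; inj₁; inj₂; [_,_]; [_,_]′)
open import Function using (_∘_; mk⇔)
open import Relation.Nullary using (¬_; yes; no; does; contradiction)
open import Relation.Nullary.Decidable using (⌊_⌋; isYes≗does; does-⇔; toWitness)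
open import Relation.Binary.PropositionalEquality
  using (_≡_; _≢_; _≗_; refl; sym; trans; cong; cong₂; subst; ≢-sym; module ≡-Reasoning)

open +-*-Solver

private
  variable
    N K : ℕ
    c t x y : ℚ

mix : ℚ → ℚ → ℚ → ℚ
mix t x y = t · x + (1ℚ - t) · y

mix-diag : ∀ t x → mix t x x ≡ x
mix-diag = solve 2 (λ t x → t :* x :+ (con 1ℚ :- t) :* x := x) refl

mix-+ : ∀ t x₁ x₂ y₁ y₂ → mix t x₁ x₂ + mix t y₁ y₂ ≡ mix t (x₁ + y₁) (x₂ + y₂)
mix-+ = solve 5 (λ t x₁ x₂ y₁ y₂ →
  (t :* x₁ :+ (con 1ℚ :- t) :* x₂) :+ (t :* y₁ :+ (con 1ℚ :- t) :* y₂)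
    := t :* (x₁ :+ y₁) :+ (con 1ℚ :- t) :* (x₂ :+ y₂)) refl

+-nonNeg : 0ℚ ≤ x → 0ℚ ≤ y → 0ℚ ≤ x + y
+-nonNeg = ℚ.+-mono-≤

·-nonNeg : 0ℚ ≤ x → 0ℚ ≤ y → 0ℚ ≤ x · y
·-nonNeg {x} {y} 0≤x 0≤y =
  ℚ.nonNegative⁻¹ _ {{ℚ.nonNeg*nonNeg⇒nonNeg x {{nonNegative 0≤x}} y {{nonNegative 0≤y}}}}

nonNeg∧≢0⇒1/nonNeg : (0≤x : 0ℚ ≤ x) (x≢0 : x ≢ 0ℚ) → 0ℚ ≤ (1/ x) {{≢-nonZero x≢0}}
nonNeg∧≢0⇒1/nonNeg {x} 0≤x x≢0 = ℚ.<⇒≤ (ℚ.positive⁻¹ _ {{ℚ.1/pos⇒pos x {{x>0}}}})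
  where
  x>0 = ℚ.nonNeg∧nonZero⇒pos x {{nonNegative 0≤x}} {{≢-nonZero x≢0}}

+-nonNeg-≡0ˡ : 0ℚ ≤ x → 0ℚ ≤ y → x + y ≡ 0ℚ → x ≡ 0ℚ
+-nonNeg-≡0ˡ {x} {y} 0≤x 0≤y x+y≡0 = ℚ.≤-antisym x≤0 0≤x
  where
  open ℚ.≤-Reasoning
  x≤0 : x ≤ 0ℚ
  x≤0 = begin
    x       ≡⟨ ℚ.+-identityʳ x ⟨
    x + 0ℚ  ≤⟨ ℚ.+-monoʳ-≤ x 0≤y ⟩
    x + y   ≡⟨ x+y≡0 ⟩
    0ℚ      ∎

+-nonNeg-≡0ʳ : 0ℚ ≤ x → 0ℚ ≤ y → x + y ≡ 0ℚ → y ≡ 0ℚ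
+-nonNeg-≡0ʳ {x} {y} 0≤x 0≤y x+y≡0 = +-nonNeg-≡0ˡ 0≤y 0≤x (trans (ℚ.+-comm y x) x+y≡0)

·-cancelˡ-≡0 : t ≢ 0ℚ → t · x ≡ 0ℚ → x ≡ 0ℚ
·-cancelˡ-≡0 {t} {x} t≢0 tx≡0 = begin
  x                 ≡⟨ ℚ.*-identityˡ x ⟨
  1ℚ · x            ≡⟨ cong (_· x) (ℚ.*-inverseˡ t) ⟨
  (1/ t · t) · x    ≡⟨ ℚ.*-assoc (1/ t) t x ⟩
  1/ t · (t · x)    ≡⟨ cong (1/ t ·_) tx≡0 ⟩
  1/ t · 0ℚ         ≡⟨ ℚ.*-zeroʳ (1/ t) ⟩
  0ℚ                ∎
  where
  open ≡-Reasoning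
  instance _ = ≢-nonZero t≢0

pos⇒≢0 : 0ℚ < t → t ≢ 0ℚ
pos⇒≢0 0<t = ≢-sym (ℚ.<⇒≢ 0<t)

<1⇒1-pos : t < 1ℚ → 0ℚ < 1ℚ - t
<1⇒1-pos {t} t<1 = subst (_< 1ℚ - t) (ℚ.+-inverseʳ t) (ℚ.+-monoˡ-< (- t) t<1)

mix-nonNeg-≡0 : 0ℚ < t → t < 1ℚ → 0ℚ ≤ x → 0ℚ ≤ y → mix t x y ≡ 0ℚ → x ≡ 0ℚ × y ≡ 0ℚ
mix-nonNeg-≡0 {t} 0<t t<1 0≤x 0≤y mix≡0 =
  ·-cancelˡ-≡0 (pos⇒≢0 0<t) (+-nonNeg-≡0ˡ 0≤t·x 0≤[1-t]·y mix≡0) ,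
  ·-cancelˡ-≡0 (pos⇒≢0 (<1⇒1-pos t<1)) (+-nonNeg-≡0ʳ 0≤t·x 0≤[1-t]·y mix≡0)
  where
  0≤t·x = ·-nonNeg (ℚ.<⇒≤ 0<t) 0≤x
  0≤[1-t]·y = ·-nonNeg (ℚ.<⇒≤ (<1⇒1-pos t<1)) 0≤y

module ℚΣ = SemiringSum (CommutativeRing.semiring ℚ.+-*-commutativeRing)

sumFin≡sum : (f : Fin N → ℚ) → sumFin f ≡ ℚΣ.sum f
sumFin≡sum {zero}  f = refl
sumFin≡sum {suc N} f = cong (f zero +_) (sumFin≡sum (f ∘ suc))

sumFin-cong : {f g : Fin N → ℚ} → f ≗ g → sumFin f ≡ sumFin g
sumFin-cong {f = f} {g} f≗g = begin
  sumFin f   ≡⟨ sumFin≡sum f ⟩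
  ℚΣ.sum f   ≡⟨ ℚΣ.sum-cong-≗ f≗g ⟩
  ℚΣ.sum g   ≡⟨ sumFin≡sum g ⟨
  sumFin g   ∎
  where open ≡-Reasoning

sumFin-+ : (f g : Fin N → ℚ) → sumFin (λ i → f i + g i) ≡ sumFin f + sumFin g
sumFin-+ f g = begin
  sumFin (λ i → f i + g i)   ≡⟨ sumFin≡sum (λ i → f i + g i) ⟩
  ℚΣ.sum (λ i → f i + g i)   ≡⟨ ℚΣ.∑-distrib-+ f g ⟩
  ℚΣ.sum f + ℚΣ.sum g        ≡⟨ cong₂ _+_ (sumFin≡sum f) (sumFin≡sum g) ⟨
  sumFin f + sumFin g        ∎
  where open ≡-Reasoning

sumFin-· : ∀ c (f : Fin N → ℚ) → sumFin (λ i → c · f i) ≡ c · sumFin f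
sumFin-· c f = begin
  sumFin (λ i → c · f i)   ≡⟨ sumFin≡sum (λ i → c · f i) ⟩
  ℚΣ.sum (λ i → c · f i)   ≡⟨ ℚΣ.*-distribˡ-sum c f ⟨
  c · ℚΣ.sum f             ≡⟨ cong (c ·_) (sumFin≡sum f) ⟨
  c · sumFin f             ∎
  where open ≡-Reasoning

sumFin-zeros : sumFin {N} (λ _ → 0ℚ) ≡ 0ℚ
sumFin-zeros {N} = trans (sumFin≡sum {N} (λ _ → 0ℚ)) (ℚΣ.sum-replicate-zero N)

sumFin-nonNeg : (f : Fin N → ℚ) → (∀ i → 0ℚ ≤ f i) → 0ℚ ≤ sumFin f
sumFin-nonNeg {zero}  f 0≤f = ℚ.≤-refl
sumFin-nonNeg {suc N} f 0≤f = +-nonNeg (0≤f zero) (sumFin-nonNeg (f ∘ suc) (0≤f ∘ suc))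

sumFin-nonNeg-≡0 : (f : Fin N → ℚ) → (∀ i → 0ℚ ≤ f i) → sumFin f ≡ 0ℚ → ∀ i → f i ≡ 0ℚ
sumFin-nonNeg-≡0 f 0≤f Σf≡0 zero =
  +-nonNeg-≡0ˡ (0≤f zero) (sumFin-nonNeg (f ∘ suc) (0≤f ∘ suc)) Σf≡0
sumFin-nonNeg-≡0 f 0≤f Σf≡0 (suc i) =
  sumFin-nonNeg-≡0 (f ∘ suc) (0≤f ∘ suc)
    (+-nonNeg-≡0ʳ (0≤f zero) (sumFin-nonNeg (f ∘ suc) (0≤f ∘ suc)) Σf≡0) i

sumFin-supported : (f : Fin N → ℚ) (j : Fin N) → (∀ i → i ≢ j → f i ≡ 0ℚ) → sumFin f ≡ f j
sumFin-supported {suc N} f zero f≡0 = begin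
  f zero + sumFin (f ∘ suc)       ≡⟨ cong (f zero +_) (sumFin-cong (λ i → f≡0 (suc i) λ ())) ⟩
  f zero + sumFin {N} (λ _ → 0ℚ)  ≡⟨ cong (f zero +_) (sumFin-zeros {N}) ⟩
  f zero + 0ℚ                     ≡⟨ ℚ.+-identityʳ (f zero) ⟩
  f zero                          ∎
  where open ≡-Reasoning
sumFin-supported {suc N} f (suc j) f≡0 = begin
  f zero + sumFin (f ∘ suc)  ≡⟨ cong (_+ sumFin (f ∘ suc)) (f≡0 zero λ ()) ⟩
  0ℚ + sumFin (f ∘ suc)      ≡⟨ ℚ.+-identityˡ (sumFin (f ∘ suc)) ⟩
  sumFin (f ∘ suc)           ≡⟨ sumFin-supported (f ∘ suc) j (λ i i≢j → f≡0 (suc i) (i≢j ∘ Finₚ.suc-injective)) ⟩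
  f (suc j)                  ∎
  where open ≡-Reasoning

sumFin-≢0 : (f : Fin N → ℚ) → sumFin f ≢ 0ℚ → ∃ λ j → f j ≢ 0ℚ
sumFin-≢0 {zero}  f Σf≢0 = contradiction refl Σf≢0
sumFin-≢0 {suc N} f Σf≢0 with f zero ≟ 0ℚ
... | no  f₀≢0 = zero , f₀≢0
... | yes f₀≡0 with sumFin-≢0 (f ∘ suc) (λ Σ≡0 → Σf≢0 (cong₂ _+_ f₀≡0 Σ≡0))
...   | j , fj≢0 = suc j , fj≢0

δ : ℕ → ℕ → ℚ
δ p n = if n ℕ.≡ᵇ p then 1ℚ else 0ℚ

δ-diag : ∀ p → δ p p ≡ 1ℚ
δ-diag zero    = refl
δ-diag (suc p) = δ-diag p

δ-offDiag : ∀ {p n} → n ≢ p → δ p n ≡ 0ℚ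
δ-offDiag {zero}  {zero}  n≢p = contradiction refl n≢p
δ-offDiag {zero}  {suc n} n≢p = refl
δ-offDiag {suc p} {zero}  n≢p = refl
δ-offDiag {suc p} {suc n} n≢p = δ-offDiag (n≢p ∘ cong suc)

δ-nonNeg : ∀ p n → 0ℚ ≤ δ p n
δ-nonNeg p n with n ℕ.≡ᵇ p
... | true  = ℚ.<⇒≤ (ℚ.positive⁻¹ 1ℚ)
... | false = ℚ.≤-refl

sumFin-δ : ∀ {N p} → p ℕ.< N → sumFin {N} (δ p ∘ toℕ) ≡ 1ℚ
sumFin-δ {suc N} {zero}  _         = trans (cong (1ℚ +_) (sumFin-zeros {N})) (ℚ.+-identityʳ 1ℚ)
sumFin-δ {suc N} {suc p} (s≤s p<N) = trans (ℚ.+-identityˡ _) (sumFin-δ p<N)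

e : Fin N → Fin N → ℚ
e j i = δ (toℕ j) (toℕ i)

e-diag : (j : Fin N) → e j j ≡ 1ℚ
e-diag j = δ-diag (toℕ j)

e-offDiag : {i j : Fin N} → i ≢ j → e j i ≡ 0ℚ
e-offDiag i≢j = δ-offDiag (i≢j ∘ Finₚ.toℕ-injective)

sumFin-e : (j : Fin N) → sumFin (e j) ≡ 1ℚ
sumFin-e j = sumFin-δ (Finₚ.toℕ<n j)

-- Flow polytopes with rational supplies

-- InFlowPolytope a, IsVertex a and NumVertices a are definitionally InPolytopeℚ b, IsVertexℚ b
-- and Count (IsVertexℚ b) (defined below) for b i = a i / 1.
InPolytopeℚ : (Fin N → ℚ) → Flow N → Set
InPolytopeℚ {N} b f =
  ((i j : Fin N) → i Fin.< j → 0ℚ ≤ f i j) ×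
  ((i : Fin N) → inflow f i + b i ≡ outflow f i)

IsVertexℚ : (Fin N → ℚ) → Flow N → Set
IsVertexℚ {N} b f =
  InPolytopeℚ b f ×
  ((g h : Flow N) (t : ℚ) → InPolytopeℚ b g → InPolytopeℚ b h →
   0ℚ < t → t < 1ℚ → f ≈F convex t g h → g ≈F h)

InPolytopeℚ-resp : {b b′ : Fin N → ℚ} {f : Flow N} → b ≗ b′ → InPolytopeℚ b f → InPolytopeℚ b′ f
InPolytopeℚ-resp {f = f} b≗b′ (f≥0 , conservation) =
  f≥0 , λ i → trans (cong (inflow f i +_) (sym (b≗b′ i))) (conservation i)

IsVertexℚ-resp : {b b′ : Fin N → ℚ} {f : Flow N} → b ≗ b′ → IsVertexℚ b f → IsVertexℚ b′ f
IsVertexℚ-resp b≗b′ (f∈ , extreme) =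
  InPolytopeℚ-resp b≗b′ f∈ ,
  λ g h t g∈ h∈ → extreme g h t (InPolytopeℚ-resp (sym ∘ b≗b′) g∈) (InPolytopeℚ-resp (sym ∘ b≗b′) h∈)

≈F-sym : {f g : Flow N} → f ≈F g → g ≈F f
≈F-sym f≈g i j i<j = sym (f≈g i j i<j)

row : Flow (suc N) → Fin N → ℚ
row f j = f zero (suc j)

rest : Flow (suc N) → Flow N
rest f i j = f (suc i) (suc j)

extend : (Fin N → ℚ) → Flow N → Flow (suc N)
extend ρ g zero    zero    = 0ℚ
extend ρ g zero    (suc j) = ρ j
extend ρ g (suc i) zero    = 0ℚ
extend ρ g (suc i) (suc j) = g i j

≈F-row : {f g : Flow (suc N)} → f ≈F g → row f ≗ row g
≈F-row f≈g j = f≈g zero (suc j) (s≤s z≤n)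

≈F-rest : {f g : Flow (suc N)} → f ≈F g → rest f ≈F rest g
≈F-rest f≈g i j i<j = f≈g (suc i) (suc j) (s≤s i<j)

≈F-split : {f g : Flow (suc N)} → row f ≗ row g → rest f ≈F rest g → f ≈F g
≈F-split row≗ rest≈ zero    (suc j) _         = row≗ j
≈F-split row≗ rest≈ (suc i) (suc j) (s≤s i<j) = rest≈ i j i<j

suc<?suc : (i j : Fin N) → ⌊ suc i <? suc j ⌋ ≡ ⌊ i <? j ⌋
suc<?suc i j = begin
  ⌊ suc i <? suc j ⌋     ≡⟨ isYes≗does (suc i <? suc j) ⟩
  does (suc i <? suc j)  ≡⟨ does-⇔ (mk⇔ ℕₚ.≤-pred s≤s) (suc i <? suc j) (i <? j) ⟩
  does (i <? j)          ≡⟨ isYes≗does (i <? j) ⟨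
  ⌊ i <? j ⌋             ∎
  where open ≡-Reasoning

inflow-source : (f : Flow (suc N)) → inflow f zero ≡ 0ℚ
inflow-source {N} f = trans (ℚ.+-identityˡ _) (sumFin-zeros {N})

outflow-source : (f : Flow (suc N)) → outflow f zero ≡ sumFin (row f)
outflow-source f = ℚ.+-identityˡ (sumFin (row f))

inflow-suc : (f : Flow (suc N)) (i : Fin N) → inflow f (suc i) ≡ row f i + inflow (rest f) i
inflow-suc f i = cong (row f i +_) (sumFin-cong λ g →
  cong (λ b → if b then f (suc g) (suc i) else 0ℚ) (suc<?suc g i))

outflow-suc : (f : Flow (suc N)) (i : Fin N) → outflow f (suc i) ≡ outflow (rest f) i
outflow-suc f i = trans (ℚ.+-identityˡ _) (sumFin-cong λ j →
  cong (λ b → if b then f (suc i) (suc j) else 0ℚ) (suc<?suc i j))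

InSimplex : ℚ → (Fin N → ℚ) → Set
InSimplex c ρ = (∀ j → 0ℚ ≤ ρ j) × sumFin ρ ≡ c

residual : (Fin (suc N) → ℚ) → (Fin N → ℚ) → Fin N → ℚ
residual b ρ i = b (suc i) + ρ i

module _ {b : Fin (suc N) → ℚ} where

  ∈⇒row∈simplex : {f : Flow (suc N)} → InPolytopeℚ b f → InSimplex (b zero) (row f)
  ∈⇒row∈simplex {f} (f≥0 , conservation) = (λ j → f≥0 zero (suc j) (s≤s z≤n)) , (begin
    sumFin (row f)           ≡⟨ outflow-source f ⟨
    outflow f zero           ≡⟨ conservation zero ⟨
    inflow f zero + b zero   ≡⟨ cong (_+ b zero) (inflow-source f) ⟩
    0ℚ + b zero              ≡⟨ ℚ.+-identityˡ (b zero) ⟩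
    b zero                   ∎)
    where open ≡-Reasoning

  ∈⇒rest∈ : {f : Flow (suc N)} → InPolytopeℚ b f → InPolytopeℚ (residual b (row f)) (rest f)
  ∈⇒rest∈ {f} (f≥0 , conservation) = (λ i j i<j → f≥0 (suc i) (suc j) (s≤s i<j)) , λ i → begin
    inflow (rest f) i + (b (suc i) + row f i)   ≡⟨ solve 3 (λ a x c → a :+ (x :+ c) := (c :+ a) :+ x) refl
                                                      (inflow (rest f) i) (b (suc i)) (row f i) ⟩
    (row f i + inflow (rest f) i) + b (suc i)   ≡⟨ cong (_+ b (suc i)) (inflow-suc f i) ⟨
    inflow f (suc i) + b (suc i)                ≡⟨ conservation (suc i) ⟩
    outflow f (suc i)                           ≡⟨ outflow-suc f i ⟩
    outflow (rest f) i                          ∎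
    where open ≡-Reasoning

  extend-∈ : {ρ : Fin N → ℚ} {g : Flow N} →
             InSimplex (b zero) ρ → InPolytopeℚ (residual b ρ) g → InPolytopeℚ b (extend ρ g)
  extend-∈ {ρ} {g} (ρ≥0 , Σρ) (g≥0 , conservation) = extend≥0 , extend-conservation
    where
    open ≡-Reasoning
    extend≥0 : (i j : Fin (suc N)) → i Fin.< j → 0ℚ ≤ extend ρ g i j
    extend≥0 zero    (suc j) _         = ρ≥0 j
    extend≥0 (suc i) (suc j) (s≤s i<j) = g≥0 i j i<j
    extend-conservation : (i : Fin (suc N)) → inflow (extend ρ g) i + b i ≡ outflow (extend ρ g) i
    extend-conservation zero = begin
      inflow (extend ρ g) zero + b zero   ≡⟨ cong (_+ b zero) (inflow-source (extend ρ g)) ⟩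
      0ℚ + b zero                         ≡⟨ ℚ.+-identityˡ (b zero) ⟩
      b zero                              ≡⟨ Σρ ⟨
      sumFin ρ                            ≡⟨ outflow-source (extend ρ g) ⟨
      outflow (extend ρ g) zero           ∎
    extend-conservation (suc i) = begin
      inflow (extend ρ g) (suc i) + b (suc i)   ≡⟨ cong (_+ b (suc i)) (inflow-suc (extend ρ g) i) ⟩
      (ρ i + inflow g i) + b (suc i)            ≡⟨ solve 3 (λ a x c → (c :+ a) :+ x := a :+ (x :+ c)) refl
                                                    (inflow g i) (b (suc i)) (ρ i) ⟩
      inflow g i + (b (suc i) + ρ i)            ≡⟨ conservation i ⟩
      outflow g i                               ≡⟨ outflow-suc (extend ρ g) i ⟨
      outflow (extend ρ g) (suc i)              ∎

Admissible : (Fin N → ℚ) → Set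
Admissible {N} b = (∀ i → suc (toℕ i) ℕ.< N → 0ℚ ≤ b i) × sumFin b ≡ 0ℚ

Admissible-source≥0 : {b : Fin (suc N) → ℚ} → Admissible b → 0ℚ ≤ b zero
Admissible-source≥0 {zero}  {b} (_ , Σb≡0) = ℚ.≤-reflexive (sym (trans (sym (ℚ.+-identityʳ (b zero))) Σb≡0))
Admissible-source≥0 {suc N}     (b≥0 , _)  = b≥0 zero (s≤s (s≤s z≤n))

Admissible-residual : {b : Fin (suc N) → ℚ} {ρ : Fin N → ℚ} →
                      Admissible b → InSimplex (b zero) ρ → Admissible (residual b ρ)
Admissible-residual {b = b} {ρ} (b≥0 , Σb≡0) (ρ≥0 , Σρ) =
  (λ i i<N → +-nonNeg (b≥0 (suc i) (s≤s i<N)) (ρ≥0 i)) , (begin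
    sumFin (residual b ρ)         ≡⟨ sumFin-+ (b ∘ suc) ρ ⟩
    sumFin (b ∘ suc) + sumFin ρ   ≡⟨ cong (sumFin (b ∘ suc) +_) Σρ ⟩
    sumFin (b ∘ suc) + b zero     ≡⟨ ℚ.+-comm (sumFin (b ∘ suc)) (b zero) ⟩
    sumFin b                      ≡⟨ Σb≡0 ⟩
    0ℚ                            ∎)
  where open ≡-Reasoning

residual-mix : ∀ t {b b₁ b₂ : Fin (suc N) → ℚ} {ρ ρ₁ ρ₂ : Fin N → ℚ} →
               (∀ i → b i ≡ mix t (b₁ i) (b₂ i)) → (∀ j → ρ j ≡ mix t (ρ₁ j) (ρ₂ j)) →
               ∀ i → residual b ρ i ≡ mix t (residual b₁ ρ₁ i) (residual b₂ ρ₂ i)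
residual-mix t {b₁ = b₁} {b₂} {ρ₁ = ρ₁} {ρ₂} b≗mix ρ≗mix i =
  trans (cong₂ _+_ (b≗mix (suc i)) (ρ≗mix i)) (mix-+ t (b₁ (suc i)) (b₂ (suc i)) (ρ₁ i) (ρ₂ i))

simplex-mix-split : ∀ {a₁ a₂} {ρ : Fin N → ℚ} → 0ℚ < t → t < 1ℚ → 0ℚ ≤ a₁ → 0ℚ ≤ a₂ →
  c ≡ mix t a₁ a₂ → InSimplex c ρ →
  ∃₂ λ ρ₁ ρ₂ → InSimplex a₁ ρ₁ × InSimplex a₂ ρ₂ × (∀ j → ρ j ≡ mix t (ρ₁ j) (ρ₂ j))
simplex-mix-split {N = N} {t = t} {a₁ = a₁} {a₂} {ρ} 0<t t<1 a₁≥0 a₂≥0 c≡S (ρ≥0 , Σρ)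
  with mix t a₁ a₂ ≟ 0ℚ
... | yes S≡0 =
  ρ , ρ , (ρ≥0 , trans Σρ′ (sym a₁≡0)) , (ρ≥0 , trans Σρ′ (sym a₂≡0)) , λ j → sym (mix-diag t (ρ j))
  where
  Σρ′ = trans Σρ (trans c≡S S≡0)
  a₁≡0 = proj₁ (mix-nonNeg-≡0 0<t t<1 a₁≥0 a₂≥0 S≡0)
  a₂≡0 = proj₂ (mix-nonNeg-≡0 0<t t<1 a₁≥0 a₂≥0 S≡0)
... | no S≢0 = scaled a₁ , scaled a₂ , scaled∈ a₁≥0 , scaled∈ a₂≥0 , ρ≗mix
  where
  open ≡-Reasoning
  S = mix t a₁ a₂
  instance _ = ≢-nonZero S≢0
  scaled : ℚ → Fin N → ℚ
  scaled a j = (a · 1/ S) · ρ j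
  S≥0 : 0ℚ ≤ S
  S≥0 = +-nonNeg (·-nonNeg (ℚ.<⇒≤ 0<t) a₁≥0) (·-nonNeg (ℚ.<⇒≤ (<1⇒1-pos t<1)) a₂≥0)
  scaled∈ : ∀ {a} → 0ℚ ≤ a → InSimplex a (scaled a)
  scaled∈ {a} a≥0 = (λ j → ·-nonNeg (·-nonNeg a≥0 (nonNeg∧≢0⇒1/nonNeg S≥0 S≢0)) (ρ≥0 j)) , (begin
    sumFin (scaled a)       ≡⟨ sumFin-· (a · 1/ S) ρ ⟩
    (a · 1/ S) · sumFin ρ   ≡⟨ cong ((a · 1/ S) ·_) (trans Σρ c≡S) ⟩
    (a · 1/ S) · S          ≡⟨ ℚ.*-assoc a (1/ S) S ⟩
    a · (1/ S · S)          ≡⟨ cong (a ·_) (ℚ.*-inverseˡ S) ⟩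
    a · 1ℚ                  ≡⟨ ℚ.*-identityʳ a ⟩
    a                       ∎)
  ρ≗mix : ∀ j → ρ j ≡ mix t (scaled a₁ j) (scaled a₂ j)
  ρ≗mix j = sym (begin
    mix t (scaled a₁ j) (scaled a₂ j)
      ≡⟨ solve 5 (λ t a₁ a₂ s x → t :* ((a₁ :* s) :* x) :+ (con 1ℚ :- t) :* ((a₂ :* s) :* x)
                                   := (t :* a₁ :+ (con 1ℚ :- t) :* a₂) :* s :* x)
           refl t a₁ a₂ (1/ S) (ρ j) ⟩
    (S · 1/ S) · ρ j
      ≡⟨ cong (_· ρ j) (ℚ.*-inverseʳ S) ⟩
    1ℚ · ρ j
      ≡⟨ ℚ.*-identityˡ (ρ j) ⟩
    ρ j ∎)

∈-mix-split : {b b₁ b₂ : Fin N → ℚ} → Admissible b₁ → Admissible b₂ → 0ℚ < t → t < 1ℚ →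
  (∀ i → b i ≡ mix t (b₁ i) (b₂ i)) → {f : Flow N} → InPolytopeℚ b f →
  ∃₂ λ g h → InPolytopeℚ b₁ g × InPolytopeℚ b₂ h × f ≈F convex t g h
∈-mix-split {zero} _ _ _ _ _ {f} _ = f , f , ((λ ()) , λ ()) , ((λ ()) , λ ()) , λ ()
∈-mix-split {suc N} {t} adm₁ adm₂ 0<t t<1 b≗mix f∈ =
  let ρ₁ , ρ₂ , ρ₁∈ , ρ₂∈ , row≗mix =
        simplex-mix-split 0<t t<1 (Admissible-source≥0 adm₁) (Admissible-source≥0 adm₂) (b≗mix zero)
          (∈⇒row∈simplex f∈)
      g , h , g∈ , h∈ , rest≈ =
        ∈-mix-split (Admissible-residual adm₁ ρ₁∈) (Admissible-residual adm₂ ρ₂∈) 0<t t<1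
          (residual-mix t b≗mix row≗mix) (∈⇒rest∈ f∈)
  in extend ρ₁ g , extend ρ₂ h , extend-∈ ρ₁∈ g∈ , extend-∈ ρ₂∈ h∈ , ≈F-split row≗mix rest≈

-- Extreme points of a simplex

ExtremeInSimplex : ℚ → (Fin N → ℚ) → Set
ExtremeInSimplex {N} c ρ = ∀ {ρ₁ ρ₂ : Fin N → ℚ} {t} → InSimplex c ρ₁ → InSimplex c ρ₂ →
  0ℚ < t → t < 1ℚ → (∀ j → ρ j ≡ mix t (ρ₁ j) (ρ₂ j)) → ρ₁ ≗ ρ₂

-- A splitting of the first row lifts, through ∈-mix-split on the remaining vertices,
-- to a splitting of the whole flow.
vertex-row-extreme : {b : Fin (suc N) → ℚ} {f : Flow (suc N)} →
                     Admissible b → IsVertexℚ b f → ExtremeInSimplex (b zero) (row f)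
vertex-row-extreme {b = b} adm (f∈ , f-extreme) {ρ₁} {ρ₂} {t} ρ₁∈ ρ₂∈ 0<t t<1 row≗mix =
  let g , h , g∈ , h∈ , rest≈ =
        ∈-mix-split (Admissible-residual adm ρ₁∈) (Admissible-residual adm ρ₂∈) 0<t t<1
          (residual-mix t (sym ∘ mix-diag t ∘ b) row≗mix) (∈⇒rest∈ f∈)
  in ≈F-row (f-extreme (extend ρ₁ g) (extend ρ₂ h) t (extend-∈ ρ₁∈ g∈) (extend-∈ ρ₂∈ h∈) 0<t t<1
               (≈F-split row≗mix rest≈))

simplex₀-zero : {ρ : Fin N → ℚ} → c ≡ 0ℚ → InSimplex c ρ → ∀ j → ρ j ≡ 0ℚ
simplex₀-zero {ρ = ρ} c≡0 (ρ≥0 , Σρ) = sumFin-nonNeg-≡0 ρ ρ≥0 (trans Σρ c≡0)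

simplex₀-extreme : {ρ : Fin N → ℚ} → c ≡ 0ℚ → ExtremeInSimplex c ρ
simplex₀-extreme c≡0 ρ₁∈ ρ₂∈ _ _ _ j = trans (simplex₀-zero c≡0 ρ₁∈ j) (sym (simplex₀-zero c≡0 ρ₂∈ j))

unit-diag : ∀ c (j : Fin N) → c · e j j ≡ c
unit-diag c j = trans (cong (c ·_) (e-diag j)) (ℚ.*-identityʳ c)

unit-offDiag : ∀ c {i j : Fin N} → i ≢ j → c · e j i ≡ 0ℚ
unit-offDiag c i≢j = trans (cong (c ·_) (e-offDiag i≢j)) (ℚ.*-zeroʳ c)

unit-inSimplex : 0ℚ ≤ c → (j : Fin N) → InSimplex c (λ i → c · e j i)
unit-inSimplex {c} c≥0 j =
  (λ i → ·-nonNeg c≥0 (δ-nonNeg (toℕ j) (toℕ i))) ,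
  trans (sumFin-· c (e j)) (trans (cong (c ·_) (sumFin-e j)) (ℚ.*-identityʳ c))

unit-extreme : ∀ c (j : Fin N) → ExtremeInSimplex c (λ i → c · e j i)
unit-extreme c j {ρ₁} {ρ₂} (ρ₁≥0 , Σρ₁) (ρ₂≥0 , Σρ₂) 0<t t<1 unit≗mix = ρ₁≗ρ₂
  where
  off : ∀ i → i ≢ j → ρ₁ i ≡ 0ℚ × ρ₂ i ≡ 0ℚ
  off i i≢j = mix-nonNeg-≡0 0<t t<1 (ρ₁≥0 i) (ρ₂≥0 i) (trans (sym (unit≗mix i)) (unit-offDiag c i≢j))
  ρ₁≗ρ₂ : ρ₁ ≗ ρ₂
  ρ₁≗ρ₂ i with i Finₚ.≟ j
  ... | yes refl = begin
    ρ₁ i       ≡⟨ sumFin-supported ρ₁ i (λ k k≢i → proj₁ (off k k≢i)) ⟨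
    sumFin ρ₁  ≡⟨ trans Σρ₁ (sym Σρ₂) ⟩
    sumFin ρ₂  ≡⟨ sumFin-supported ρ₂ i (λ k k≢i → proj₂ (off k k≢i)) ⟩
    ρ₂ i       ∎
    where open ≡-Reasoning
  ... | no i≢j = trans (proj₁ (off i i≢j)) (sym (proj₂ (off i i≢j)))

transfer : ℚ → Fin N → Fin N → (Fin N → ℚ) → Fin N → ℚ
transfer x i j ρ k = (ρ k + x · e i k) + (- x) · e j k

module _ {x : ℚ} {i j : Fin N} {ρ : Fin N → ℚ} where

  transfer-target : i ≢ j → transfer x i j ρ i ≡ ρ i + x
  transfer-target i≢j = begin
    (ρ i + x · e i i) + (- x) · e j i
      ≡⟨ cong₂ (λ a b → (ρ i + x · a) + (- x) · b) (e-diag i) (e-offDiag i≢j) ⟩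
    (ρ i + x · 1ℚ) + (- x) · 0ℚ
      ≡⟨ solve 2 (λ r x → (r :+ x :* con 1ℚ) :+ (:- x) :* con 0ℚ := r :+ x) refl (ρ i) x ⟩
    ρ i + x ∎
    where open ≡-Reasoning

  transfer-source : i ≢ j → transfer x i j ρ j ≡ ρ j - x
  transfer-source i≢j = begin
    (ρ j + x · e i j) + (- x) · e j j
      ≡⟨ cong₂ (λ a b → (ρ j + x · a) + (- x) · b) (e-offDiag (i≢j ∘ sym)) (e-diag j) ⟩
    (ρ j + x · 0ℚ) + (- x) · 1ℚ
      ≡⟨ solve 2 (λ r x → (r :+ x :* con 0ℚ) :+ (:- x) :* con 1ℚ := r :- x) refl (ρ j) x ⟩
    ρ j - x ∎
    where open ≡-Reasoning

  transfer-elsewhere : ∀ {k} → k ≢ i → k ≢ j → transfer x i j ρ k ≡ ρ k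
  transfer-elsewhere {k} k≢i k≢j = begin
    (ρ k + x · e i k) + (- x) · e j k
      ≡⟨ cong₂ (λ a b → (ρ k + x · a) + (- x) · b) (e-offDiag k≢i) (e-offDiag k≢j) ⟩
    (ρ k + x · 0ℚ) + (- x) · 0ℚ
      ≡⟨ solve 2 (λ r x → (r :+ x :* con 0ℚ) :+ (:- x) :* con 0ℚ := r) refl (ρ k) x ⟩
    ρ k ∎
    where open ≡-Reasoning

  transfer-inSimplex : i ≢ j → 0ℚ ≤ x → x ≤ ρ j → InSimplex c ρ → InSimplex c (transfer x i j ρ)
  transfer-inSimplex {c} i≢j x≥0 x≤ρj (ρ≥0 , Σρ) = transfer≥0 , (begin
    sumFin (transfer x i j ρ)
      ≡⟨ sumFin-+ (λ k → ρ k + x · e i k) (λ k → (- x) · e j k) ⟩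
    sumFin (λ k → ρ k + x · e i k) + sumFin (λ k → (- x) · e j k)
      ≡⟨ cong₂ _+_ (sumFin-+ ρ (λ k → x · e i k)) (sumFin-· (- x) (e j)) ⟩
    (sumFin ρ + sumFin (λ k → x · e i k)) + (- x) · sumFin (e j)
      ≡⟨ cong₂ (λ a b → (sumFin ρ + a) + (- x) · b)
           (trans (sumFin-· x (e i)) (cong (x ·_) (sumFin-e i))) (sumFin-e j) ⟩
    (sumFin ρ + x · 1ℚ) + (- x) · 1ℚ
      ≡⟨ solve 2 (λ s x → (s :+ x :* con 1ℚ) :+ (:- x) :* con 1ℚ := s) refl (sumFin ρ) x ⟩
    sumFin ρ
      ≡⟨ Σρ ⟩
    c ∎)
    where
    open ≡-Reasoning
    transfer≥0 : ∀ k → 0ℚ ≤ transfer x i j ρ k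
    transfer≥0 k with k Finₚ.≟ i | k Finₚ.≟ j
    ... | yes refl | _        = subst (0ℚ ≤_) (sym (transfer-target i≢j)) (+-nonNeg (ρ≥0 i) x≥0)
    ... | no _     | yes refl = subst (0ℚ ≤_) (sym (transfer-source i≢j))
                                  (subst (_≤ ρ j - x) (ℚ.+-inverseʳ x) (ℚ.+-monoˡ-≤ (- x) x≤ρj))
    ... | no k≢i   | no k≢j   = subst (0ℚ ≤_) (sym (transfer-elsewhere k≢i k≢j)) (ρ≥0 k)

  transfer-mix : ∀ k → ρ k ≡ mix ½ (transfer x i j ρ k) (transfer x j i ρ k)
  transfer-mix k = solve 4 (λ r x a b → r := con ½ :* ((r :+ x :* a) :+ (:- x) :* b)
                                          :+ (con 1ℚ :- con ½) :* ((r :+ x :* b) :+ (:- x) :* a))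
                     refl (ρ k) x (e i k) (e j k)

-- Moving ρ i from j to i, or from i to j, gives two points of the simplex with midpoint ρ.
extreme-minor≡0 : {ρ : Fin N → ℚ} {i j : Fin N} → InSimplex c ρ → ExtremeInSimplex c ρ →
                  i ≢ j → ρ i ≤ ρ j → ρ i ≡ 0ℚ
extreme-minor≡0 {ρ = ρ} {i} {j} ρ∈ ρ-extreme i≢j ρi≤ρj = +-nonNeg-≡0ˡ ρi≥0 ρi≥0 (begin
  ρ i + ρ i                     ≡⟨ transfer-target {x = ρ i} {ρ = ρ} i≢j ⟨
  transfer (ρ i) i j ρ i        ≡⟨ ρ-extreme (transfer-inSimplex i≢j ρi≥0 ρi≤ρj ρ∈)
                                              (transfer-inSimplex (i≢j ∘ sym) ρi≥0 ℚ.≤-refl ρ∈)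
                                              (ℚ.positive⁻¹ ½) half<1 (transfer-mix {x = ρ i}) i ⟩
  transfer (ρ i) j i ρ i        ≡⟨ transfer-source {x = ρ i} {ρ = ρ} (i≢j ∘ sym) ⟩
  ρ i - ρ i                     ≡⟨ ℚ.+-inverseʳ (ρ i) ⟩
  0ℚ                            ∎)
  where
  open ≡-Reasoning
  ρi≥0 = proj₁ ρ∈ i
  half<1 : ½ < 1ℚ
  half<1 = toWitness {a? = ½ ℚ.<? 1ℚ} _

extreme⇒unit : {ρ : Fin N → ℚ} → c ≢ 0ℚ → InSimplex c ρ → ExtremeInSimplex c ρ →
               ∃ λ j → ∀ i → ρ i ≡ c · e j i
extreme⇒unit {c = c} {ρ} c≢0 ρ∈@(_ , Σρ) ρ-extreme = j , ρ≗unit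
  where
  support = sumFin-≢0 ρ (λ Σρ≡0 → c≢0 (trans (sym Σρ) Σρ≡0))
  j = proj₁ support
  off : ∀ i → i ≢ j → ρ i ≡ 0ℚ
  off i i≢j with ℚ.≤-total (ρ i) (ρ j)
  ... | inj₁ ρi≤ρj = extreme-minor≡0 ρ∈ ρ-extreme i≢j ρi≤ρj
  ... | inj₂ ρj≤ρi = contradiction (extreme-minor≡0 ρ∈ ρ-extreme (i≢j ∘ sym) ρj≤ρi) (proj₂ support)
  ρ≗unit : ∀ i → ρ i ≡ c · e j i
  ρ≗unit i with i Finₚ.≟ j
  ... | yes refl = trans (sym (sumFin-supported ρ i off)) (trans Σρ (sym (unit-diag c i)))
  ... | no i≢j   = trans (off i i≢j) (sym (unit-offDiag c i≢j))

-- Counting vertices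

Count : (Flow N → Set) → ℕ → Set
Count {N} P K =
  Σ (Fin K → Flow N) λ v →
    ((k : Fin K) → P (v k)) ×
    ((k l : Fin K) → k ≢ l → ¬ (v k ≈F v l)) ×
    ((f : Flow N) → P f → ∃ λ k → f ≈F v k)

Count-resp : {P Q : Flow N → Set} → (∀ {f} → P f → Q f) → (∀ {f} → Q f → P f) → Count P K → Count Q K
Count-resp P⇒Q Q⇒P (v , P-v , v-distinct , v-complete) =
  v , P⇒Q ∘ P-v , v-distinct , λ f → v-complete f ∘ Q⇒P

Count-⊥ : Count {N} (λ _ → ⊥) 0
Count-⊥ = (λ ()) , (λ ()) , (λ ()) , λ _ ()

Count-⊎ : ∀ {P Q : Flow N → Set} {K₁ K₂} → Count P K₁ → Count Q K₂ →
          (∀ {f g} → P f → Q g → ¬ f ≈F g) → Count (λ f → P f ⊎ Q f) (K₁ ℕ.+ K₂)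
Count-⊎ {N} {P} {Q} {K₁} {K₂}
        (v₁ , P-v₁ , v₁-distinct , v₁-complete) (v₂ , Q-v₂ , v₂-distinct , v₂-complete) P≉Q =
  w ∘ Fin.splitAt K₁ , w-prop ∘ Fin.splitAt K₁ , v-distinct , v-complete
  where
  open ≡-Reasoning
  w : Fin K₁ ⊎ Fin K₂ → Flow N
  w = [ v₁ , v₂ ]′
  w-prop : ∀ x → P (w x) ⊎ Q (w x)
  w-prop = [ inj₁ ∘ P-v₁ , inj₂ ∘ Q-v₂ ]
  w-distinct : ∀ x y → x ≢ y → ¬ (w x ≈F w y)
  w-distinct (inj₁ a) (inj₁ a′) x≢y = v₁-distinct a a′ (x≢y ∘ cong inj₁)
  w-distinct (inj₁ a) (inj₂ b)  _   = P≉Q (P-v₁ a) (Q-v₂ b)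
  w-distinct (inj₂ b) (inj₁ a)  _   = P≉Q (P-v₁ a) (Q-v₂ b) ∘ ≈F-sym
  w-distinct (inj₂ b) (inj₂ b′) x≢y = v₂-distinct b b′ (x≢y ∘ cong inj₂)
  v-distinct : ∀ k l → k ≢ l → ¬ (w (Fin.splitAt K₁ k) ≈F w (Fin.splitAt K₁ l))
  v-distinct k l k≢l = w-distinct (Fin.splitAt K₁ k) (Fin.splitAt K₁ l) λ eq → k≢l (begin
    k                                 ≡⟨ Finₚ.join-splitAt K₁ K₂ k ⟨
    Fin.join K₁ K₂ (Fin.splitAt K₁ k)  ≡⟨ cong (Fin.join K₁ K₂) eq ⟩
    Fin.join K₁ K₂ (Fin.splitAt K₁ l)  ≡⟨ Finₚ.join-splitAt K₁ K₂ l ⟩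
    l                                 ∎)
  w-complete : ∀ f → P f ⊎ Q f → ∃ λ x → f ≈F w x
  w-complete f (inj₁ Pf) = let a , f≈ = v₁-complete f Pf in inj₁ a , f≈
  w-complete f (inj₂ Qf) = let b , f≈ = v₂-complete f Qf in inj₂ b , f≈
  v-complete : ∀ f → P f ⊎ Q f → ∃ λ k → f ≈F w (Fin.splitAt K₁ k)
  v-complete f PQf = let x , f≈ = w-complete f PQf in
    Fin.join K₁ K₂ x , subst (λ y → f ≈F w y) (sym (Finₚ.splitAt-join K₁ K₂ x)) f≈

Count-⋃ : ∀ {M} {P : Fin M → Flow N → Set} {K : Fin M → ℕ} → (∀ j → Count (P j) (K j)) →
          (∀ {j j′ f g} → j ≢ j′ → P j f → P j′ g → ¬ f ≈F g) →
          Count (λ f → ∃ λ j → P j f) (sum K)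
Count-⋃ {M = zero} _ _ = Count-resp (λ ()) (λ ()) Count-⊥
Count-⋃ {M = suc M} {P} count P-disjoint =
  Count-resp [ (zero ,_) , (λ (j , Pf) → suc j , Pf) ]′ split
    (Count-⊎ (count zero) (Count-⋃ (count ∘ suc) (λ j≢j′ → P-disjoint (j≢j′ ∘ Finₚ.suc-injective)))
      (λ P₀f (j , Pg) → P-disjoint (λ ()) P₀f Pg))
  where
  split : ∀ {f} → (∃ λ j → P j f) → P zero f ⊎ (∃ λ j → P (suc j) f)
  split (zero  , Pf) = inj₁ Pf
  split (suc j , Pf) = inj₂ (j , Pf)

Count-vertices-resp : {b b′ : Fin N → ℚ} → b ≗ b′ → Count (IsVertexℚ b) K → Count (IsVertexℚ b′) K
Count-vertices-resp b≗b′ = Count-resp (IsVertexℚ-resp b≗b′) (IsVertexℚ-resp (sym ∘ b≗b′))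

Count-vertices-empty : (b : Fin 0 → ℚ) → Count (IsVertexℚ b) 1
Count-vertices-empty b =
  (λ _ ()) , (λ _ → ((λ ()) , (λ ())) , λ _ _ _ _ _ _ _ _ ()) , distinct , λ _ _ → zero , λ ()
  where
  distinct : (k l : Fin 1) → k ≢ l → ¬ ((λ ()) ≈F (λ ()))
  distinct zero zero 0≢0 _ = 0≢0 refl

Count-fiber : {b : Fin (suc N) → ℚ} {ρ : Fin N → ℚ} →
              InSimplex (b zero) ρ → ExtremeInSimplex (b zero) ρ →
              Count (IsVertexℚ (residual b ρ)) K → Count (λ f → IsVertexℚ b f × row f ≗ ρ) K
Count-fiber {b = b} {ρ} ρ∈ ρ-extreme (v , v-vertex , v-distinct , v-complete) =
  extend ρ ∘ v , (λ k → extend-vertex (v-vertex k) , λ _ → refl) ,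
  (λ k l k≢l → v-distinct k l k≢l ∘ ≈F-rest) , complete
  where
  residual-resp : ∀ {ρ′} → ρ′ ≗ ρ → residual b ρ′ ≗ residual b ρ
  residual-resp ρ′≗ρ i = cong (b (suc i) +_) (ρ′≗ρ i)

  extend-vertex : ∀ {g} → IsVertexℚ (residual b ρ) g → IsVertexℚ b (extend ρ g)
  extend-vertex (g∈ , g-extreme) = extend-∈ ρ∈ g∈ , λ g₁ h₁ t g₁∈ h₁∈ 0<t t<1 extend≈mix →
    let row₁≗row₂ = ρ-extreme (∈⇒row∈simplex g₁∈) (∈⇒row∈simplex h₁∈) 0<t t<1 (≈F-row extend≈mix)
        row₁≗ρ : row g₁ ≗ ρ
        row₁≗ρ j = begin
          row g₁ j                       ≡⟨ mix-diag t (row g₁ j) ⟨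
          mix t (row g₁ j) (row g₁ j)    ≡⟨ cong (mix t (row g₁ j)) (row₁≗row₂ j) ⟩
          mix t (row g₁ j) (row h₁ j)    ≡⟨ ≈F-row extend≈mix j ⟨
          ρ j                            ∎
        row₂≗ρ j = trans (sym (row₁≗row₂ j)) (row₁≗ρ j)
    in ≈F-split row₁≗row₂
         (g-extreme (rest g₁) (rest h₁) t
           (InPolytopeℚ-resp (residual-resp row₁≗ρ) (∈⇒rest∈ g₁∈))
           (InPolytopeℚ-resp (residual-resp row₂≗ρ) (∈⇒rest∈ h₁∈))
           0<t t<1 (≈F-rest extend≈mix))
    where open ≡-Reasoning

  rest-vertex : ∀ {f} → IsVertexℚ b f → row f ≗ ρ → IsVertexℚ (residual b ρ) (rest f)
  rest-vertex (f∈ , f-extreme) row≗ρ =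
    InPolytopeℚ-resp (residual-resp row≗ρ) (∈⇒rest∈ f∈) , λ g h t g∈ h∈ 0<t t<1 rest≈mix →
      ≈F-rest (f-extreme (extend ρ g) (extend ρ h) t (extend-∈ ρ∈ g∈) (extend-∈ ρ∈ h∈) 0<t t<1
                (≈F-split (λ j → trans (row≗ρ j) (sym (mix-diag t (ρ j)))) rest≈mix))

  complete : ∀ f → IsVertexℚ b f × row f ≗ ρ → ∃ λ k → f ≈F extend ρ (v k)
  complete f (f-vertex , row≗ρ) =
    let k , rest≈ = v-complete (rest f) (rest-vertex f-vertex row≗ρ) in k , ≈F-split row≗ρ rest≈

Count-vertices-zeroSupply : {b : Fin (suc N) → ℚ} → b zero ≡ 0ℚ →
                            Count (IsVertexℚ (b ∘ suc)) K → Count (IsVertexℚ b) K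
Count-vertices-zeroSupply {N} {b = b} b₀≡0 count =
  Count-resp proj₁ (λ f-vertex → f-vertex , simplex₀-zero b₀≡0 (∈⇒row∈simplex (proj₁ f-vertex)))
    (Count-fiber 0∈ (simplex₀-extreme b₀≡0)
      (Count-vertices-resp (λ i → sym (ℚ.+-identityʳ (b (suc i)))) count))
  where
  0∈ : InSimplex (b zero) (λ _ → 0ℚ)
  0∈ = (λ _ → ℚ.≤-refl) , trans (sumFin-zeros {N}) (sym b₀≡0)

Count-vertices-nonzeroSupply : {b : Fin (suc N) → ℚ} {K : Fin N → ℕ} → Admissible b → b zero ≢ 0ℚ →
  (∀ j → Count (IsVertexℚ (residual b (λ i → b zero · e j i))) (K j)) → Count (IsVertexℚ b) (sum K)
Count-vertices-nonzeroSupply {b = b} adm b₀≢0 count =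
  Count-resp (proj₁ ∘ proj₂) vertex⇒fiber
    (Count-⋃ (λ j → Count-fiber (unit-inSimplex (Admissible-source≥0 adm) j) (unit-extreme b₀ j) (count j))
      fibers-disjoint)
  where
  b₀ = b zero
  vertex⇒fiber : ∀ {f} → IsVertexℚ b f → ∃ λ j → IsVertexℚ b f × row f ≗ (λ i → b₀ · e j i)
  vertex⇒fiber f-vertex =
    let j , row≗unit = extreme⇒unit b₀≢0 (∈⇒row∈simplex (proj₁ f-vertex)) (vertex-row-extreme adm f-vertex)
    in j , f-vertex , row≗unit
  fibers-disjoint : ∀ {j j′ f g} → j ≢ j′ → IsVertexℚ b f × row f ≗ (λ i → b₀ · e j i) →
                    IsVertexℚ b g × row g ≗ (λ i → b₀ · e j′ i) → ¬ f ≈F g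
  fibers-disjoint {j} {j′} {f} {g} j≢j′ (_ , row-f) (_ , row-g) f≈g = b₀≢0 (begin
    b₀           ≡⟨ unit-diag b₀ j ⟨
    b₀ · e j j   ≡⟨ row-f j ⟨
    row f j      ≡⟨ ≈F-row f≈g j ⟩
    row g j      ≡⟨ row-g j ⟩
    b₀ · e j′ j  ≡⟨ unit-offDiag b₀ j≢j′ ⟩
    0ℚ           ∎)
    where open ≡-Reasoning

-- Vertex 0 either has zero supply and is deleted, or sends its whole supply b 0 along a single
-- edge (0, j + 1), which adds b 0 to the supply of j + 1.
vertexCount : ℕ → (ℕ → ℚ) → ℕ
vertexCount zero    b = 1
vertexCount (suc N) b with b 0 ≟ 0ℚ
... | yes _ = vertexCount N (b ∘ suc)
... | no  _ = ∑[ j < N ] vertexCount N (λ n → b (suc n) + b 0 · δ (toℕ j) n)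

vertexCount-correct : ∀ N (b : ℕ → ℚ) → Admissible {N} (b ∘ toℕ) →
                      Count {N} (IsVertexℚ (b ∘ toℕ)) (vertexCount N b)
vertexCount-correct zero    b _   = Count-vertices-empty (b ∘ toℕ)
vertexCount-correct (suc N) b adm with b 0 ≟ 0ℚ
... | yes b₀≡0 = Count-vertices-zeroSupply {b = b ∘ toℕ} b₀≡0 (vertexCount-correct N (b ∘ suc) adm′)
  where
  adm′ : Admissible {N} (b ∘ suc ∘ toℕ)
  adm′ = (λ i i<N → proj₁ adm (suc i) (s≤s i<N)) , (begin
    Σb′               ≡⟨ ℚ.+-identityˡ Σb′ ⟨
    0ℚ + Σb′          ≡⟨ cong (_+ Σb′) b₀≡0 ⟨
    b 0 + Σb′         ≡⟨ proj₂ adm ⟩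
    0ℚ                ∎)
    where
    open ≡-Reasoning
    Σb′ = sumFin {N} (b ∘ suc ∘ toℕ)
... | no  b₀≢0 = Count-vertices-nonzeroSupply {b = b ∘ toℕ} adm b₀≢0 λ j →
  vertexCount-correct N (λ n → b (suc n) + b 0 · δ (toℕ j) n)
    (Admissible-residual adm (unit-inSimplex (Admissible-source≥0 adm) j))

vertexCount-zeroSupply : ∀ {N} {b : ℕ → ℚ} → b 0 ≡ 0ℚ → vertexCount (suc N) b ≡ vertexCount N (b ∘ suc)
vertexCount-zeroSupply {b = b} b₀≡0 with b 0 ≟ 0ℚ
... | yes _     = refl
... | no  b₀≢0 = contradiction b₀≡0 b₀≢0

vertexCount-nonzeroSupply : ∀ {N} {b : ℕ → ℚ} → b 0 ≢ 0ℚ →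
  vertexCount (suc N) b ≡ ∑[ j < N ] vertexCount N (λ n → b (suc n) + b 0 · δ (toℕ j) n)
vertexCount-nonzeroSupply {b = b} b₀≢0 with b 0 ≟ 0ℚ
... | yes b₀≡0 = contradiction b₀≡0 b₀≢0
... | no _     = refl

vertexCount-cong : ∀ N {b b′ : ℕ → ℚ} → b ≗ b′ → vertexCount N b ≡ vertexCount N b′
vertexCount-cong zero    b≗b′ = refl
vertexCount-cong (suc N) {b} {b′} b≗b′ with b 0 ≟ 0ℚ
... | yes b₀≡0 = trans (vertexCount-cong N (b≗b′ ∘ suc))
                       (sym (vertexCount-zeroSupply {N} {b′} (trans (sym (b≗b′ 0)) b₀≡0)))
... | no  b₀≢0 = trans (sum-cong-≗ {N} λ j → vertexCount-cong N λ n →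
                         cong₂ (λ x y → x + y · δ (toℕ j) n) (b≗b′ (suc n)) (b≗b′ 0))
                       (sym (vertexCount-nonzeroSupply {N} {b′} (b₀≢0 ∘ trans (b≗b′ 0))))

-- Two unit sources and one sink

-2ℚ : ℚ
-2ℚ = - (1ℚ + 1ℚ)

twoUnits : ℕ → ℕ → ℕ → ℕ → ℚ
twoUnits a b m n = (δ a n + δ b n) + -2ℚ · δ m n

twoUnits-value : ∀ a b m n {x y z} → δ a n ≡ x → δ b n ≡ y → δ m n ≡ z →
                 twoUnits a b m n ≡ (x + y) + -2ℚ · z
twoUnits-value a b m n refl refl refl = refl

twoUnits-admissible : ∀ {a b m} → a ℕ.≤ m → b ℕ.≤ m → Admissible {suc m} (twoUnits a b m ∘ toℕ)
twoUnits-admissible {a} {b} {m} a≤m b≤m = nonNeg , (begin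
  total (twoUnits a b m)
    ≡⟨ sumFin-+ {suc m} (λ i → δ a (toℕ i) + δ b (toℕ i)) (λ i → -2ℚ · δ m (toℕ i)) ⟩
  total (λ n → δ a n + δ b n) + total (λ n → -2ℚ · δ m n)
    ≡⟨ cong₂ _+_ (sumFin-+ {suc m} (δ a ∘ toℕ) (δ b ∘ toℕ)) (sumFin-· {suc m} -2ℚ (δ m ∘ toℕ)) ⟩
  (total (δ a) + total (δ b)) + -2ℚ · total (δ m)
    ≡⟨ cong₂ (λ x y → x + -2ℚ · y) (cong₂ _+_ (sumFin-δ (s≤s a≤m)) (sumFin-δ (s≤s b≤m)))
         (sumFin-δ {p = m} ℕₚ.≤-refl) ⟩
  (1ℚ + 1ℚ) + -2ℚ · 1ℚ
    ≡⟨⟩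
  0ℚ ∎)
  where
  open ≡-Reasoning
  total : (ℕ → ℚ) → ℚ
  total f = sumFin {suc m} (f ∘ toℕ)
  nonNeg : ∀ i → suc (toℕ i) ℕ.< suc m → 0ℚ ≤ twoUnits a b m (toℕ i)
  nonNeg i (s≤s i<m) = subst (0ℚ ≤_) (sym (begin
    twoUnits a b m (toℕ i)                      ≡⟨ twoUnits-value a b m (toℕ i) refl refl (δ-offDiag (ℕₚ.<⇒≢ i<m)) ⟩
    (δ a (toℕ i) + δ b (toℕ i)) + -2ℚ · 0ℚ      ≡⟨ solve 1 (λ x → x :+ con -2ℚ :* con 0ℚ := x) refl _ ⟩
    δ a (toℕ i) + δ b (toℕ i)                   ∎))
    (+-nonNeg (δ-nonNeg a (toℕ i)) (δ-nonNeg b (toℕ i)))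

twoUnitCount : ℕ → ℕ → ℕ → ℕ
twoUnitCount zero    _       _       = 1
twoUnitCount (suc m) zero    zero    = ∑[ j < suc m ] twoUnitCount m (toℕ j) (toℕ j)
twoUnitCount (suc m) zero    (suc b) = ∑[ j < suc m ] twoUnitCount m (toℕ j) b
twoUnitCount (suc m) (suc a) zero    = ∑[ j < suc m ] twoUnitCount m a (toℕ j)
twoUnitCount (suc m) (suc a) (suc b) = twoUnitCount m a b

twoUnits-merge : ∀ m j n →
  twoUnits 0 0 (suc m) (suc n) + twoUnits 0 0 (suc m) 0 · δ j n ≡ twoUnits j j m n
twoUnits-merge m j n = solve 2 (λ x z →
  ((con 0ℚ :+ con 0ℚ) :+ con -2ℚ :* z) :+ (con 1ℚ :+ con 1ℚ) :* x := (x :+ x) :+ con -2ℚ :* z)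
  refl (δ j n) (δ m n)

twoUnits-moveˡ : ∀ m b j n →
  twoUnits 0 (suc b) (suc m) (suc n) + twoUnits 0 (suc b) (suc m) 0 · δ j n ≡ twoUnits j b m n
twoUnits-moveˡ m b j n = solve 3 (λ x y z →
  ((con 0ℚ :+ y) :+ con -2ℚ :* z) :+ con 1ℚ :* x := (x :+ y) :+ con -2ℚ :* z)
  refl (δ j n) (δ b n) (δ m n)

twoUnits-moveʳ : ∀ m a j n →
  twoUnits (suc a) 0 (suc m) (suc n) + twoUnits (suc a) 0 (suc m) 0 · δ j n ≡ twoUnits a j m n
twoUnits-moveʳ m a j n = solve 3 (λ x y z →
  ((y :+ con 0ℚ) :+ con -2ℚ :* z) :+ con 1ℚ :* x := (y :+ x) :+ con -2ℚ :* z)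
  refl (δ j n) (δ a n) (δ m n)

vertexCount-twoUnits : ∀ m {a b} → a ℕ.≤ m → b ℕ.≤ m →
                       vertexCount (suc m) (twoUnits a b m) ≡ twoUnitCount m a b
vertexCount-twoUnits zero    {zero}  {zero}  _ _ = vertexCount-zeroSupply {0} {twoUnits 0 0 0} refl
vertexCount-twoUnits (suc m) {zero}  {zero}  _ _ =
  trans (vertexCount-nonzeroSupply {b = twoUnits 0 0 (suc m)} (λ ())) (sum-cong-≗ {suc m} λ j →
    trans (vertexCount-cong (suc m) (twoUnits-merge m (toℕ j)))
          (vertexCount-twoUnits m (Finₚ.toℕ≤pred[n] j) (Finₚ.toℕ≤pred[n] j)))
vertexCount-twoUnits (suc m) {zero}  {suc b} _ (s≤s b≤m) =
  trans (vertexCount-nonzeroSupply {b = twoUnits 0 (suc b) (suc m)} (λ ())) (sum-cong-≗ {suc m} λ j →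
    trans (vertexCount-cong (suc m) (twoUnits-moveˡ m b (toℕ j)))
          (vertexCount-twoUnits m (Finₚ.toℕ≤pred[n] j) b≤m))
vertexCount-twoUnits (suc m) {suc a} {zero}  (s≤s a≤m) _ =
  trans (vertexCount-nonzeroSupply {b = twoUnits (suc a) 0 (suc m)} (λ ())) (sum-cong-≗ {suc m} λ j →
    trans (vertexCount-cong (suc m) (twoUnits-moveʳ m a (toℕ j)))
          (vertexCount-twoUnits m a≤m (Finₚ.toℕ≤pred[n] j)))
vertexCount-twoUnits (suc m) {suc a} {suc b} (s≤s a≤m) (s≤s b≤m) =
  trans (vertexCount-zeroSupply {b = twoUnits (suc a) (suc b) (suc m)} refl) (vertexCount-twoUnits m a≤m b≤m)

twoUnitCount-sym : ∀ m a b → twoUnitCount m a b ≡ twoUnitCount m b a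
twoUnitCount-sym zero    _       _       = refl
twoUnitCount-sym (suc m) zero    zero    = refl
twoUnitCount-sym (suc m) zero    (suc b) = sum-cong-≗ {suc m} λ j → twoUnitCount-sym m (toℕ j) b
twoUnitCount-sym (suc m) (suc a) zero    = sum-cong-≗ {suc m} λ j → twoUnitCount-sym m a (toℕ j)
twoUnitCount-sym (suc m) (suc a) (suc b) = twoUnitCount-sym m a b

pairSum : ℕ → ℕ
pairSum m = ∑[ b < suc m ] ∑[ a < suc m ] twoUnitCount m (toℕ a) (toℕ b)

double : ∀ x → x ℕ.+ x ≡ 2 * x
double = solve-∀

twoUnitCount-merged : ∀ m → twoUnitCount (suc m) 0 0 ≡ 2 ^ m
twoUnitCount-merged zero    = refl
twoUnitCount-merged (suc m) =
  trans (cong₂ ℕ._+_ (twoUnitCount-merged m) (twoUnitCount-merged m)) (double (2 ^ m))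

twoUnitCount-adjacent : ∀ m → twoUnitCount (suc (suc m)) 0 1 ≡ 2 ^ m ℕ.+ pairSum m
twoUnitCount-adjacent m = cong₂ ℕ._+_ (twoUnitCount-merged m)
  (sum-cong-≗ {suc m} λ b → sum-cong-≗ {suc m} λ a → twoUnitCount-sym m (toℕ b) (toℕ a))

pairSum-suc : ∀ m → pairSum (suc m) ≡ (2 ^ m ℕ.+ pairSum m) ℕ.+ (pairSum m ℕ.+ pairSum m)
pairSum-suc m = cong₂ ℕ._+_ (twoUnitCount-adjacent m) (∑-distrib-+ Q Q)
  where
  Q : Fin (suc m) → ℕ
  Q b = twoUnitCount (suc m) 0 (suc (toℕ b))

pairSum-closed : ∀ m → pairSum m ℕ.+ 2 ^ m ≡ 2 * 3 ^ m
pairSum-closed zero    = refl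
pairSum-closed (suc m) = begin
  pairSum (suc m) ℕ.+ 2 ^ suc m
    ≡⟨ cong (ℕ._+ 2 ^ suc m) (pairSum-suc m) ⟩
  ((2 ^ m ℕ.+ pairSum m) ℕ.+ (pairSum m ℕ.+ pairSum m)) ℕ.+ 2 * 2 ^ m
    ≡⟨ three-copies (pairSum m) (2 ^ m) ⟩
  3 * (pairSum m ℕ.+ 2 ^ m)
    ≡⟨ cong (3 *_) (pairSum-closed m) ⟩
  3 * (2 * 3 ^ m)
    ≡⟨ swap (3 ^ m) ⟩
  2 * 3 ^ suc m ∎
  where
  open ≡-Reasoning
  three-copies : ∀ p x → ((x ℕ.+ p) ℕ.+ (p ℕ.+ p)) ℕ.+ 2 * x ≡ 3 * (p ℕ.+ x)
  three-copies = solve-∀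
  swap : ∀ y → 3 * (2 * y) ≡ 2 * (3 * y)
  swap = solve-∀

twoUnitCount-closed : ∀ r s → twoUnitCount (suc (suc (r ℕ.+ s))) 0 (suc r) ≡ 2 ^ (r ℕ.+ 1) * 3 ^ s
twoUnitCount-closed zero    s = begin
  twoUnitCount (suc (suc s)) 0 1   ≡⟨ twoUnitCount-adjacent s ⟩
  2 ^ s ℕ.+ pairSum s              ≡⟨ ℕₚ.+-comm (2 ^ s) (pairSum s) ⟩
  pairSum s ℕ.+ 2 ^ s              ≡⟨ pairSum-closed s ⟩
  2 * 3 ^ s                        ∎
  where open ≡-Reasoning
twoUnitCount-closed (suc r) s = begin
  Q ℕ.+ Q                      ≡⟨ cong (λ x → x ℕ.+ x) (twoUnitCount-closed r s) ⟩
  Q′ ℕ.+ Q′                    ≡⟨ double Q′ ⟩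
  2 * (2 ^ (r ℕ.+ 1) * 3 ^ s)  ≡⟨ ℕₚ.*-assoc 2 (2 ^ (r ℕ.+ 1)) (3 ^ s) ⟨
  2 ^ (suc r ℕ.+ 1) * 3 ^ s    ∎
  where
  open ≡-Reasoning
  Q = twoUnitCount (suc (suc (r ℕ.+ s))) 0 (suc r)
  Q′ = 2 ^ (r ℕ.+ 1) * 3 ^ s

aVec≗twoUnits : ∀ r s (i : Fin (suc (suc (suc (r ℕ.+ s))))) →
                aVec r s i / 1 ≡ twoUnits 0 (suc r) (suc (suc (r ℕ.+ s))) (toℕ i)
aVec≗twoUnits r s i with toℕ i ℕ.≟ 0 | toℕ i ℕ.≟ suc r | toℕ i ℕ.≟ suc (suc (r ℕ.+ s))
... | yes i≡0 | _        | _       rewrite i≡0 = refl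
... | no _    | yes i≡r′ | _       rewrite i≡r′ =
  sym (twoUnits-value 0 (suc r) (suc (suc (r ℕ.+ s))) (suc r)
         refl (δ-diag (suc r)) (δ-offDiag (ℕₚ.<⇒≢ (s≤s (s≤s (ℕₚ.m≤m+n r s))))))
... | no _    | no _     | yes i≡m rewrite i≡m =
  sym (twoUnits-value 0 (suc r) (suc (suc (r ℕ.+ s))) (suc (suc (r ℕ.+ s)))
         refl (δ-offDiag (≢-sym (ℕₚ.<⇒≢ (s≤s (s≤s (ℕₚ.m≤m+n r s)))))) (δ-diag (suc (suc (r ℕ.+ s)))))
... | no i≢0  | no i≢r′  | no i≢m  =
  sym (twoUnits-value 0 (suc r) (suc (suc (r ℕ.+ s))) (toℕ i)
         (δ-offDiag i≢0) (δ-offDiag i≢r′) (δ-offDiag i≢m))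

theorem6p3 : (r s : ℕ) → NumVertices (aVec r s) (2 ^ (r Data.Nat.+ 1) * 3 ^ s)
theorem6p3 r s =
  subst (NumVertices (aVec r s)) (trans (vertexCount-twoUnits m z≤n r<m) (twoUnitCount-closed r s))
    (Count-vertices-resp (sym ∘ aVec≗twoUnits r s)
      (vertexCount-correct (suc m) (twoUnits 0 (suc r) m) (twoUnits-admissible z≤n r<m)))
  where
  m = suc (suc (r ℕ.+ s))
  r<m : suc r ℕ.≤ m
  r<m = s≤s (ℕₚ.m≤n⇒m≤1+n (ℕₚ.m≤m+n r s))
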